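{- Let $A_1,\dots,A_k \subseteq [n]$ and let $b_1,\dots,b_k$ be integers. For $J \subseteq [k]$ let $A(J) = \bigcup_{j\in J} A_j$ and \[ g(J) = \sum_{j\in J} b_j - \Big( \sum_{j\in J} |A_j| - |A(J)| \Big). \] Then the family \[ \mathcal{I} = \{ I \subseteq [n] : |I \cap A(J)| \le g(J) \ \ \forall J \subseteq [k] \} \] is the family of independent sets of a matroid on $[n]$, provided it is non-empty. -}

module Defs where

open import Data.Nat using (ℕ; zero; suc; _<_)
open import Data.Integer using (ℤ; +_; _+_; _-_; _≤_)
open import Data.Bool using (Bool; true; false)
open import Data.Fin using (Fin; zero; suc)
open import Data.Fin.Subset using (Subset; ⊥; ⁅_⁆; _∈_; _∉_; _⊆_; _∩_; _∪_; ∣_∣)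
open import Data.Vec using (Vec; []; _∷_)
open import Data.Product using (Σ; _×_)

sumOver : ∀ {k} → Subset k → (Fin k → ℤ) → ℤ
sumOver [] f = + 0
sumOver (true ∷ J) f = f zero + sumOver J (λ j → f (suc j))
sumOver (false ∷ J) f = sumOver J (λ j → f (suc j))

unionOver : ∀ {k n} → Subset k → (Fin k → Subset n) → Subset n
unionOver [] A = ⊥
unionOver (true ∷ J) A = A zero ∪ unionOver J (λ j → A (suc j))
unionOver (false ∷ J) A = unionOver J (λ j → A (suc j))

g : ∀ {k n} → (Fin k → Subset n) → (Fin k → ℤ) → Subset k → ℤ
g A b J = sumOver J b - (sumOver J (λ j → + ∣ A j ∣) - + ∣ unionOver J A ∣)

Indep : ∀ {k n} → (Fin k → Subset n) → (Fin k → ℤ) → Subset n → Set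
Indep A b I = ∀ (J : Subset _) → + ∣ I ∩ unionOver J A ∣ ≤ g A b J

record IsMatroid {n : ℕ} (𝓘 : Subset n → Set) : Set where
  field
    empty-indep : 𝓘 ⊥
    hereditary  : ∀ {I I′} → I′ ⊆ I → 𝓘 I → 𝓘 I′
    augment     : ∀ {I I′} → 𝓘 I → 𝓘 I′ → ∣ I ∣ < ∣ I′ ∣ →
                  Σ (Fin n) λ x → x ∈ I′ × x ∉ I × 𝓘 (I ∪ ⁅ x ⁆)

module Submission where

-- For a fixed I write g(J) = |I ∩ A(J)| + slack_I(J).  Since
-- |A(J)| = |I ∩ A(J)| + |A(J) ∖ I|, the slack equals
--     slack_I(J) = Σ_{j∈J} (b_j − |A_j|) + |A(J) ∖ I|,
-- a modular function plus a coverage function, hence it is submodular.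
-- If I is independent all slacks are ≥ 0, so the constraints that are
-- tight for I (slack ≤ 0) are closed under union.  Augmentation: if no
-- x ∈ I′ ∖ I can be added to I, every such x lies in A(J) for some tight J;
-- the union T of these J is tight and A(T) ⊇ I′ ∖ I, so
--     |I′| = |I′ ∩ A(T)| + |I′ ∖ A(T)| ≤ g(T) + |I ∖ A(T)| = |I|.

open import Defs
open import Data.Nat as ℕ using (ℕ; zero; suc; z≤n)
import Data.Nat.Properties as ℕ
open import Data.Integer using (ℤ; +_; _+_; _-_; _≤_; 0ℤ; +≤+; _≤?_)
import Data.Integer.Properties as ℤ
open import Data.Integer.Tactic.RingSolver using (solve-∀)
open import Data.Bool using (Bool; true; false; _∨_; _∧_)
open import Data.Fin using (Fin; zero; suc)
open import Data.Fin.Properties using (any?)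
open import Data.Fin.Subset using (Subset; ⊥; ⁅_⁆; ∁; _∈_; _∉_; _⊆_; _∩_; _∪_; ∣_∣)
open import Data.Fin.Subset.Properties
  using ( _∈?_; x∈p∩q⁺; x∈p∩q⁻; x∈p∪q⁺; x∈p∪q⁻; ∉⊥; ⊥⊆; x∈⁅y⁆⇒x≡y; ∣⁅x⁆∣≡1; ∣⊥∣≡0
        ; x∈∁p⇒x∉p; x∈⁅x⁆; ⊆-antisym; p⊆q⇒∣p∣≤∣q∣; ∩-comm; ∩-distribˡ-∪; anySubset? )
open import Data.Vec using ([]; _∷_; here; there)
open import Data.List using (List; []; _∷_; allFin)
import Data.List.Relation.Unary.Any as Any
import Data.List.Membership.Propositional as List
open import Data.List.Membership.Propositional.Properties using (∈-allFin)
open import Data.Product using (Σ; ∃; _×_; _,_)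
open import Data.Sum using (_⊎_; inj₁; inj₂)
open import Data.Empty using (⊥-elim)
open import Relation.Nullary using (¬_; Dec; yes; no)
open import Relation.Nullary.Decidable using (¬?; _×-dec_; decidable-stable)
open import Relation.Unary using (Decidable)
open import Relation.Binary.PropositionalEquality
  using (_≡_; refl; sym; trans; cong; cong₂; subst; subst₂; module ≡-Reasoning)

∣p∪q∣+∣p∩q∣ : ∀ {n} (p q : Subset n) → ∣ p ∪ q ∣ ℕ.+ ∣ p ∩ q ∣ ≡ ∣ p ∣ ℕ.+ ∣ q ∣
∣p∪q∣+∣p∩q∣ []          []          = refl
∣p∪q∣+∣p∩q∣ (false ∷ p) (false ∷ q) = ∣p∪q∣+∣p∩q∣ p q
∣p∪q∣+∣p∩q∣ (true  ∷ p) (false ∷ q) = cong suc (∣p∪q∣+∣p∩q∣ p q)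
∣p∪q∣+∣p∩q∣ (false ∷ p) (true  ∷ q) =
  trans (cong suc (∣p∪q∣+∣p∩q∣ p q)) (sym (ℕ.+-suc ∣ p ∣ ∣ q ∣))
∣p∪q∣+∣p∩q∣ (true  ∷ p) (true  ∷ q) = cong suc (begin
  ∣ p ∪ q ∣ ℕ.+ suc ∣ p ∩ q ∣ ≡⟨ ℕ.+-suc ∣ p ∪ q ∣ ∣ p ∩ q ∣ ⟩
  suc (∣ p ∪ q ∣ ℕ.+ ∣ p ∩ q ∣) ≡⟨ cong suc (∣p∪q∣+∣p∩q∣ p q) ⟩
  suc (∣ p ∣ ℕ.+ ∣ q ∣)         ≡⟨ ℕ.+-suc ∣ p ∣ ∣ q ∣ ⟨
  ∣ p ∣ ℕ.+ suc ∣ q ∣           ∎)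
  where open ≡-Reasoning

∣p∪q∣≤∣p∣+∣q∣ : ∀ {n} (p q : Subset n) → ∣ p ∪ q ∣ ℕ.≤ ∣ p ∣ ℕ.+ ∣ q ∣
∣p∪q∣≤∣p∣+∣q∣ p q =
  subst (∣ p ∪ q ∣ ℕ.≤_) (∣p∪q∣+∣p∩q∣ p q) (ℕ.m≤m+n ∣ p ∪ q ∣ ∣ p ∩ q ∣)

∣p∣≡∣S∩p∣+∣∁S∩p∣ : ∀ {n} (S p : Subset n) → ∣ p ∣ ≡ ∣ S ∩ p ∣ ℕ.+ ∣ ∁ S ∩ p ∣
∣p∣≡∣S∩p∣+∣∁S∩p∣ []          []          = refl
∣p∣≡∣S∩p∣+∣∁S∩p∣ (true  ∷ S) (true  ∷ p) = cong suc (∣p∣≡∣S∩p∣+∣∁S∩p∣ S p)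
∣p∣≡∣S∩p∣+∣∁S∩p∣ (false ∷ S) (true  ∷ p) =
  trans (cong suc (∣p∣≡∣S∩p∣+∣∁S∩p∣ S p)) (sym (ℕ.+-suc ∣ S ∩ p ∣ ∣ ∁ S ∩ p ∣))
∣p∣≡∣S∩p∣+∣∁S∩p∣ (true  ∷ S) (false ∷ p) = ∣p∣≡∣S∩p∣+∣∁S∩p∣ S p
∣p∣≡∣S∩p∣+∣∁S∩p∣ (false ∷ S) (false ∷ p) = ∣p∣≡∣S∩p∣+∣∁S∩p∣ S p

∣p∣≤∣q∣-via : ∀ {n} (S p q : Subset n) → ∣ p ∩ S ∣ ℕ.≤ ∣ q ∩ S ∣ →
              (∀ {x} → x ∈ p → x ∉ S → x ∈ q) → ∣ p ∣ ℕ.≤ ∣ q ∣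
∣p∣≤∣q∣-via S p q inS outS = begin
  ∣ p ∣                         ≡⟨ ∣p∣≡∣S∩p∣+∣∁S∩p∣ S p ⟩
  ∣ S ∩ p ∣ ℕ.+ ∣ ∁ S ∩ p ∣     ≤⟨ ℕ.+-mono-≤ inside outside ⟩
  ∣ S ∩ q ∣ ℕ.+ ∣ ∁ S ∩ q ∣     ≡⟨ ∣p∣≡∣S∩p∣+∣∁S∩p∣ S q ⟨
  ∣ q ∣                         ∎
  where
  open ℕ.≤-Reasoning
  inside : ∣ S ∩ p ∣ ℕ.≤ ∣ S ∩ q ∣
  inside = subst₂ ℕ._≤_ (cong ∣_∣ (∩-comm p S)) (cong ∣_∣ (∩-comm q S)) inS
  outside : ∣ ∁ S ∩ p ∣ ℕ.≤ ∣ ∁ S ∩ q ∣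
  outside = p⊆q⇒∣p∣≤∣q∣ λ x∈∁S∩p →
    let (x∈∁S , x∈p) = x∈p∩q⁻ (∁ S) p x∈∁S∩p
    in  x∈p∩q⁺ (x∈∁S , outS x∈p (λ x∈S → x∈∁p⇒x∉p x∈∁S x∈S))

∈-insert-∩⁻ : ∀ {n} (I U : Subset n) {x y : Fin n} →
              y ∈ (I ∪ ⁅ x ⁆) ∩ U → y ∈ I ∩ U ⊎ (y ≡ x × y ∈ U)
∈-insert-∩⁻ I U {x} y∈ with x∈p∩q⁻ (I ∪ ⁅ x ⁆) U y∈
... | y∈I∪x , y∈U with x∈p∪q⁻ I ⁅ x ⁆ y∈I∪x
...   | inj₁ y∈I = inj₁ (x∈p∩q⁺ (y∈I , y∈U))
...   | inj₂ y∈x = inj₂ (x∈⁅y⁆⇒x≡y x y∈x , y∈U)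

∣insert-∩∣≤ : ∀ {n} (I U : Subset n) (x : Fin n) → ∣ (I ∪ ⁅ x ⁆) ∩ U ∣ ℕ.≤ suc ∣ I ∩ U ∣
∣insert-∩∣≤ I U x = begin
  ∣ (I ∪ ⁅ x ⁆) ∩ U ∣        ≤⟨ p⊆q⇒∣p∣≤∣q∣ split ⟩
  ∣ (I ∩ U) ∪ ⁅ x ⁆ ∣        ≤⟨ ∣p∪q∣≤∣p∣+∣q∣ (I ∩ U) ⁅ x ⁆ ⟩
  ∣ I ∩ U ∣ ℕ.+ ∣ ⁅ x ⁆ ∣    ≡⟨ cong (∣ I ∩ U ∣ ℕ.+_) (∣⁅x⁆∣≡1 x) ⟩
  ∣ I ∩ U ∣ ℕ.+ 1            ≡⟨ ℕ.+-comm ∣ I ∩ U ∣ 1 ⟩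
  suc ∣ I ∩ U ∣              ∎
  where
  open ℕ.≤-Reasoning
  split : (I ∪ ⁅ x ⁆) ∩ U ⊆ (I ∩ U) ∪ ⁅ x ⁆
  split y∈ with ∈-insert-∩⁻ I U y∈
  ... | inj₁ y∈I∩U      = x∈p∪q⁺ (inj₁ y∈I∩U)
  ... | inj₂ (refl , _) = x∈p∪q⁺ (inj₂ (x∈⁅x⁆ x))

∣insert-∩∣≤-∉ : ∀ {n} (I U : Subset n) {x : Fin n} → x ∉ U → ∣ (I ∪ ⁅ x ⁆) ∩ U ∣ ℕ.≤ ∣ I ∩ U ∣
∣insert-∩∣≤-∉ I U {x} x∉U = p⊆q⇒∣p∣≤∣q∣ shrink
  where
  shrink : (I ∪ ⁅ x ⁆) ∩ U ⊆ I ∩ U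
  shrink y∈ with ∈-insert-∩⁻ I U y∈
  ... | inj₁ y∈I∩U        = y∈I∩U
  ... | inj₂ (refl , x∈U) = ⊥-elim (x∉U x∈U)

∈-unionOver⁺ : ∀ {k n} (J : Subset k) (A : Fin k → Subset n) {j x} →
               j ∈ J → x ∈ A j → x ∈ unionOver J A
∈-unionOver⁺ (true  ∷ J) A here        x∈A = x∈p∪q⁺ (inj₁ x∈A)
∈-unionOver⁺ (true  ∷ J) A (there j∈J) x∈A = x∈p∪q⁺ (inj₂ (∈-unionOver⁺ J (λ j → A (suc j)) j∈J x∈A))
∈-unionOver⁺ (false ∷ J) A (there j∈J) x∈A = ∈-unionOver⁺ J (λ j → A (suc j)) j∈J x∈A

∈-unionOver⁻ : ∀ {k n} (J : Subset k) (A : Fin k → Subset n) {x} →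
               x ∈ unionOver J A → ∃ λ j → j ∈ J × x ∈ A j
∈-unionOver⁻ []          A x∈⊥ = ⊥-elim (∉⊥ x∈⊥)
∈-unionOver⁻ (true  ∷ J) A x∈ with x∈p∪q⁻ (A zero) _ x∈
... | inj₁ x∈A₀ = zero , here , x∈A₀
... | inj₂ x∈AJ =
  let (j , j∈J , x∈Aj) = ∈-unionOver⁻ J (λ j → A (suc j)) x∈AJ in suc j , there j∈J , x∈Aj
∈-unionOver⁻ (false ∷ J) A x∈ =
  let (j , j∈J , x∈Aj) = ∈-unionOver⁻ J (λ j → A (suc j)) x∈ in suc j , there j∈J , x∈Aj

unionOver-∪ : ∀ {k n} (J₁ J₂ : Subset k) (A : Fin k → Subset n) →
              unionOver (J₁ ∪ J₂) A ≡ unionOver J₁ A ∪ unionOver J₂ A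
unionOver-∪ J₁ J₂ A = ⊆-antisym forth back
  where
  forth : unionOver (J₁ ∪ J₂) A ⊆ unionOver J₁ A ∪ unionOver J₂ A
  forth x∈ with ∈-unionOver⁻ (J₁ ∪ J₂) A x∈
  ... | j , j∈J , x∈Aj with x∈p∪q⁻ J₁ J₂ j∈J
  ...   | inj₁ j∈J₁ = x∈p∪q⁺ (inj₁ (∈-unionOver⁺ J₁ A j∈J₁ x∈Aj))
  ...   | inj₂ j∈J₂ = x∈p∪q⁺ (inj₂ (∈-unionOver⁺ J₂ A j∈J₂ x∈Aj))
  back : unionOver J₁ A ∪ unionOver J₂ A ⊆ unionOver (J₁ ∪ J₂) A
  back x∈ with x∈p∪q⁻ (unionOver J₁ A) (unionOver J₂ A) x∈
  ... | inj₁ x∈A₁ = let (j , j∈J₁ , x∈Aj) = ∈-unionOver⁻ J₁ A x∈A₁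
                    in  ∈-unionOver⁺ (J₁ ∪ J₂) A (x∈p∪q⁺ (inj₁ j∈J₁)) x∈Aj
  ... | inj₂ x∈A₂ = let (j , j∈J₂ , x∈Aj) = ∈-unionOver⁻ J₂ A x∈A₂
                    in  ∈-unionOver⁺ (J₁ ∪ J₂) A (x∈p∪q⁺ (inj₂ j∈J₂)) x∈Aj

unionOver-∩ : ∀ {k n} (J₁ J₂ : Subset k) (A : Fin k → Subset n) →
              unionOver (J₁ ∩ J₂) A ⊆ unionOver J₁ A ∩ unionOver J₂ A
unionOver-∩ J₁ J₂ A x∈ =
  let (j , j∈J₁∩J₂ , x∈Aj) = ∈-unionOver⁻ (J₁ ∩ J₂) A x∈
      (j∈J₁ , j∈J₂)        = x∈p∩q⁻ J₁ J₂ j∈J₁∩J₂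
  in  x∈p∩q⁺ (∈-unionOver⁺ J₁ A j∈J₁ x∈Aj , ∈-unionOver⁺ J₂ A j∈J₂ x∈Aj)

unionOver-⊥ : ∀ {k n} (A : Fin k → Subset n) → unionOver ⊥ A ≡ ⊥
unionOver-⊥ {zero}  A = refl
unionOver-⊥ {suc k} A = unionOver-⊥ (λ j → A (suc j))

sumOver-⊥ : ∀ {k} (f : Fin k → ℤ) → sumOver ⊥ f ≡ 0ℤ
sumOver-⊥ {zero}  f = refl
sumOver-⊥ {suc k} f = sumOver-⊥ (λ j → f (suc j))

pick : Bool → ℤ → ℤ
pick true  v = v
pick false v = 0ℤ

sumOver-∷ : ∀ {k} (x : Bool) (J : Subset k) (f : Fin (suc k) → ℤ) →
            sumOver (x ∷ J) f ≡ pick x (f zero) + sumOver J (λ j → f (suc j))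
sumOver-∷ true  J f = refl
sumOver-∷ false J f = sym (ℤ.+-identityˡ _)

pick-modular : ∀ x y v → pick (x ∨ y) v + pick (x ∧ y) v ≡ pick x v + pick y v
pick-modular true  true  v = refl
pick-modular true  false v = refl
pick-modular false true  v = ℤ.+-comm v 0ℤ
pick-modular false false v = refl

Modular : ∀ {k} → (Subset k → ℤ) → Set
Modular f = ∀ J₁ J₂ → f (J₁ ∪ J₂) + f (J₁ ∩ J₂) ≡ f J₁ + f J₂

Submodular : ∀ {k} → (Subset k → ℤ) → Set
Submodular f = ∀ J₁ J₂ → f (J₁ ∪ J₂) + f (J₁ ∩ J₂) ≤ f J₁ + f J₂

+-interchange : ∀ a b c d → (a + b) + (c + d) ≡ (a + c) + (b + d)
+-interchange = solve-∀

sumOver-modular : ∀ {k} (f : Fin k → ℤ) → Modular (λ J → sumOver J f)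
sumOver-modular f [] [] = refl
sumOver-modular f (x ∷ J₁) (y ∷ J₂) = begin
  sumOver ((x ∨ y) ∷ (J₁ ∪ J₂)) f + sumOver ((x ∧ y) ∷ (J₁ ∩ J₂)) f
    ≡⟨ cong₂ _+_ (sumOver-∷ (x ∨ y) (J₁ ∪ J₂) f) (sumOver-∷ (x ∧ y) (J₁ ∩ J₂) f) ⟩
  (pick (x ∨ y) v + S (J₁ ∪ J₂)) + (pick (x ∧ y) v + S (J₁ ∩ J₂))
    ≡⟨ +-interchange (pick (x ∨ y) v) (S (J₁ ∪ J₂)) (pick (x ∧ y) v) (S (J₁ ∩ J₂)) ⟩
  (pick (x ∨ y) v + pick (x ∧ y) v) + (S (J₁ ∪ J₂) + S (J₁ ∩ J₂))
    ≡⟨ cong₂ _+_ (pick-modular x y v) (sumOver-modular (λ j → f (suc j)) J₁ J₂) ⟩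
  (pick x v + pick y v) + (S J₁ + S J₂)
    ≡⟨ +-interchange (pick x v) (pick y v) (S J₁) (S J₂) ⟩
  (pick x v + S J₁) + (pick y v + S J₂)
    ≡⟨ cong₂ _+_ (sumOver-∷ x J₁ f) (sumOver-∷ y J₂ f) ⟨
  sumOver (x ∷ J₁) f + sumOver (y ∷ J₂) f ∎
  where
  open ≡-Reasoning
  v = f zero
  S : Subset _ → ℤ
  S J = sumOver J (λ j → f (suc j))

modular-− : ∀ {k} {f h : Subset k → ℤ} → Modular f → Modular h → Modular (λ J → f J - h J)
modular-− {f = f} {h} f-mod h-mod J₁ J₂ = begin
  (f (J₁ ∪ J₂) - h (J₁ ∪ J₂)) + (f (J₁ ∩ J₂) - h (J₁ ∩ J₂))
    ≡⟨ regroup (f (J₁ ∪ J₂)) (h (J₁ ∪ J₂)) (f (J₁ ∩ J₂)) (h (J₁ ∩ J₂)) ⟩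
  (f (J₁ ∪ J₂) + f (J₁ ∩ J₂)) - (h (J₁ ∪ J₂) + h (J₁ ∩ J₂))
    ≡⟨ cong₂ _-_ (f-mod J₁ J₂) (h-mod J₁ J₂) ⟩
  (f J₁ + f J₂) - (h J₁ + h J₂)
    ≡⟨ regroup (f J₁) (h J₁) (f J₂) (h J₂) ⟨
  (f J₁ - h J₁) + (f J₂ - h J₂) ∎
  where
  open ≡-Reasoning
  regroup : ∀ a b c d → (a - b) + (c - d) ≡ (a + c) - (b + d)
  regroup = solve-∀

modular⇒submodular : ∀ {k} {f : Subset k → ℤ} → Modular f → Submodular f
modular⇒submodular f-mod J₁ J₂ = ℤ.≤-reflexive (f-mod J₁ J₂)

submodular-+ : ∀ {k} {f h : Subset k → ℤ} → Submodular f → Submodular h → Submodular (λ J → f J + h J)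
submodular-+ {f = f} {h} f-sub h-sub J₁ J₂ = begin
  (f (J₁ ∪ J₂) + h (J₁ ∪ J₂)) + (f (J₁ ∩ J₂) + h (J₁ ∩ J₂))
    ≡⟨ +-interchange (f (J₁ ∪ J₂)) (h (J₁ ∪ J₂)) (f (J₁ ∩ J₂)) (h (J₁ ∩ J₂)) ⟩
  (f (J₁ ∪ J₂) + f (J₁ ∩ J₂)) + (h (J₁ ∪ J₂) + h (J₁ ∩ J₂))
    ≤⟨ ℤ.+-mono-≤ (f-sub J₁ J₂) (h-sub J₁ J₂) ⟩
  (f J₁ + f J₂) + (h J₁ + h J₂)
    ≡⟨ +-interchange (f J₁) (f J₂) (h J₁) (h J₂) ⟩
  (f J₁ + h J₁) + (f J₂ + h J₂) ∎
  where open ℤ.≤-Reasoning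

submodular-cong : ∀ {k} {f h : Subset k → ℤ} → (∀ J → f J ≡ h J) → Submodular h → Submodular f
submodular-cong {f = f} {h} f≗h h-sub J₁ J₂ =
  subst₂ _≤_ (sym (cong₂ _+_ (f≗h (J₁ ∪ J₂)) (f≗h (J₁ ∩ J₂))))
             (sym (cong₂ _+_ (f≗h J₁) (f≗h J₂))) (h-sub J₁ J₂)

coverage-submodular : ∀ {k n} (X : Subset n) (A : Fin k → Subset n) →
                      Submodular (λ J → + ∣ X ∩ unionOver J A ∣)
coverage-submodular X A J₁ J₂ =
  subst₂ _≤_ (ℤ.pos-+ ∣ X ∩ unionOver (J₁ ∪ J₂) A ∣ ∣ X ∩ unionOver (J₁ ∩ J₂) A ∣)
             (ℤ.pos-+ ∣ P ∣ ∣ Q ∣) (+≤+ counted)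
  where
  open ℕ.≤-Reasoning
  P = X ∩ unionOver J₁ A
  Q = X ∩ unionOver J₂ A
  X∩A∪ : X ∩ unionOver (J₁ ∪ J₂) A ≡ P ∪ Q
  X∩A∪ = trans (cong (X ∩_) (unionOver-∪ J₁ J₂ A)) (∩-distribˡ-∪ X _ _)
  X∩A∩ : X ∩ unionOver (J₁ ∩ J₂) A ⊆ P ∩ Q
  X∩A∩ x∈ =
    let (x∈X , x∈A) = x∈p∩q⁻ X _ x∈
        (x∈A₁ , x∈A₂) = x∈p∩q⁻ (unionOver J₁ A) _ (unionOver-∩ J₁ J₂ A x∈A)
    in  x∈p∩q⁺ (x∈p∩q⁺ (x∈X , x∈A₁) , x∈p∩q⁺ (x∈X , x∈A₂))
  counted : ∣ X ∩ unionOver (J₁ ∪ J₂) A ∣ ℕ.+ ∣ X ∩ unionOver (J₁ ∩ J₂) A ∣ ℕ.≤ ∣ P ∣ ℕ.+ ∣ Q ∣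
  counted = begin
    ∣ X ∩ unionOver (J₁ ∪ J₂) A ∣ ℕ.+ ∣ X ∩ unionOver (J₁ ∩ J₂) A ∣
      ≡⟨ cong (λ Z → ∣ Z ∣ ℕ.+ ∣ X ∩ unionOver (J₁ ∩ J₂) A ∣) X∩A∪ ⟩
    ∣ P ∪ Q ∣ ℕ.+ ∣ X ∩ unionOver (J₁ ∩ J₂) A ∣
      ≤⟨ ℕ.+-monoʳ-≤ ∣ P ∪ Q ∣ (p⊆q⇒∣p∣≤∣q∣ X∩A∩) ⟩
    ∣ P ∪ Q ∣ ℕ.+ ∣ P ∩ Q ∣
      ≡⟨ ∣p∪q∣+∣p∩q∣ P Q ⟩
    ∣ P ∣ ℕ.+ ∣ Q ∣ ∎

all-or-counterexample : ∀ {k} {P : Subset k → Set} → Decidable P → (∀ J → P J) ⊎ ∃ λ J → ¬ P J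
all-or-counterexample P? with anySubset? (λ J → ¬? (P? J))
... | yes counterexample = inj₂ counterexample
... | no  none           = inj₁ λ J → decidable-stable (P? J) (λ ¬PJ → none (J , ¬PJ))

module Constraints {k n : ℕ} (A : Fin k → Subset n) (b : Fin k → ℤ) where

  𝓘 : Subset n → Set
  𝓘 = Indep A b

  Violated : Subset n → Subset k → Set
  Violated I J = ¬ (+ ∣ I ∩ unionOver J A ∣ ≤ g A b J)

  indep-or-violated : ∀ I → 𝓘 I ⊎ ∃ (Violated I)
  indep-or-violated I = all-or-counterexample (λ J → + ∣ I ∩ unionOver J A ∣ ≤? g A b J)

  indep? : ∀ I → Dec (𝓘 I)
  indep? I with indep-or-violated I
  ... | inj₁ I∈𝓘     = yes I∈𝓘
  ... | inj₂ (J , v) = no λ I∈𝓘 → v (I∈𝓘 J)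

  𝓘-hereditary : ∀ {I I′} → I′ ⊆ I → 𝓘 I → 𝓘 I′
  𝓘-hereditary {I} {I′} I′⊆I I∈𝓘 J = ℤ.≤-trans (+≤+ (p⊆q⇒∣p∣≤∣q∣ shrink)) (I∈𝓘 J)
    where
    shrink : I′ ∩ unionOver J A ⊆ I ∩ unionOver J A
    shrink x∈ = let (x∈I′ , x∈A) = x∈p∩q⁻ I′ _ x∈ in x∈p∩q⁺ (I′⊆I x∈I′ , x∈A)

  -- The modular part of g: Σ_{j∈J} (b_j − |A_j|).
  w : Subset k → ℤ
  w J = sumOver J b - sumOver J (λ j → + ∣ A j ∣)

  w-modular : Modular w
  w-modular = modular-− {f = λ J → sumOver J b} {h = λ J → sumOver J (λ j → + ∣ A j ∣)}
    (sumOver-modular b) (sumOver-modular (λ j → + ∣ A j ∣))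

  slack : Subset n → Subset k → ℤ
  slack I J = g A b J - + ∣ I ∩ unionOver J A ∣

  slack-formula : ∀ I J → slack I J ≡ w J + + ∣ ∁ I ∩ unionOver J A ∣
  slack-formula I J = begin
    sB - (sA - + ∣ U ∣) - + ∣ I ∩ U ∣
      ≡⟨ cong (λ z → sB - (sA - z) - + ∣ I ∩ U ∣) split ⟩
    sB - (sA - (+ ∣ I ∩ U ∣ + + ∣ ∁ I ∩ U ∣)) - + ∣ I ∩ U ∣
      ≡⟨ cancel sB sA (+ ∣ I ∩ U ∣) (+ ∣ ∁ I ∩ U ∣) ⟩
    (sB - sA) + + ∣ ∁ I ∩ U ∣ ∎
    where
    open ≡-Reasoning
    U  = unionOver J A
    sB = sumOver J b
    sA = sumOver J (λ j → + ∣ A j ∣)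
    split : + ∣ U ∣ ≡ + ∣ I ∩ U ∣ + + ∣ ∁ I ∩ U ∣
    split = trans (cong +_ (∣p∣≡∣S∩p∣+∣∁S∩p∣ I U)) (ℤ.pos-+ ∣ I ∩ U ∣ ∣ ∁ I ∩ U ∣)
    cancel : ∀ s t u v → s - (t - (u + v)) - u ≡ (s - t) + v
    cancel = solve-∀

  slack-submodular : ∀ I → Submodular (slack I)
  slack-submodular I = submodular-cong (slack-formula I)
    (submodular-+ {f = w} {h = λ J → + ∣ ∁ I ∩ unionOver J A ∣}
       (modular⇒submodular {f = w} w-modular) (coverage-submodular (∁ I) A))

  𝓘⇒0≤slack : ∀ {I} → 𝓘 I → ∀ J → 0ℤ ≤ slack I J
  𝓘⇒0≤slack I∈𝓘 J = ℤ.i≤j⇒0≤j-i (I∈𝓘 J)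

  -- The constraint for J is tight at I (with equality if I is independent).
  Tight : Subset n → Subset k → Set
  Tight I J = g A b J ≤ + ∣ I ∩ unionOver J A ∣

  tight-⊥ : ∀ I → Tight I ⊥
  tight-⊥ I = subst (_≤ + ∣ I ∩ unionOver ⊥ A ∣) (sym g⊥≡0) (+≤+ z≤n)
    where
    g⊥≡0 : g A b ⊥ ≡ 0ℤ
    g⊥≡0 rewrite sumOver-⊥ b | sumOver-⊥ (λ j → + ∣ A j ∣) | unionOver-⊥ A | ∣⊥∣≡0 n = refl

  -- Tight constraints of an independent set are closed under union:
  -- slack(J₁ ∪ J₂) ≤ slack(J₁ ∪ J₂) + slack(J₁ ∩ J₂) ≤ slack(J₁) + slack(J₂) ≤ 0.
  tight-∪ : ∀ {I J₁ J₂} → 𝓘 I → Tight I J₁ → Tight I J₂ → Tight I (J₁ ∪ J₂)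
  tight-∪ {I} {J₁} {J₂} I∈𝓘 t₁ t₂ = ℤ.i-j≤0⇒i≤j (begin
    slack I (J₁ ∪ J₂)                       ≡⟨ ℤ.+-identityʳ _ ⟨
    slack I (J₁ ∪ J₂) + 0ℤ                  ≤⟨ ℤ.+-monoʳ-≤ (slack I (J₁ ∪ J₂)) (𝓘⇒0≤slack {I} I∈𝓘 (J₁ ∩ J₂)) ⟩
    slack I (J₁ ∪ J₂) + slack I (J₁ ∩ J₂)   ≤⟨ slack-submodular I J₁ J₂ ⟩
    slack I J₁ + slack I J₂                 ≤⟨ ℤ.+-mono-≤ (ℤ.i≤j⇒i-j≤0 t₁) (ℤ.i≤j⇒i-j≤0 t₂) ⟩
    0ℤ                                      ∎)
    where open ℤ.≤-Reasoning

  -- If adding x to an independent I violates the constraint for J, then J is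
  -- tight at I and x ∈ A(J): g(J) < |(I ∪ {x}) ∩ A(J)| ≤ |I ∩ A(J)| + 1, and
  -- x ∉ A(J) is impossible, as then |(I ∪ {x}) ∩ A(J)| ≤ |I ∩ A(J)| ≤ g(J).
  violated-tight : ∀ {I J x} → 𝓘 I → Violated (I ∪ ⁅ x ⁆) J → Tight I J × x ∈ unionOver J A
  violated-tight {I} {J} {x} I∈𝓘 v with x ∈? unionOver J A
  ... | yes x∈U = ℤ.i<j⇒i≤pred[j] (ℤ.<-≤-trans (ℤ.≰⇒> v) (+≤+ (∣insert-∩∣≤ I U x))) , x∈U
    where U = unionOver J A
  ... | no  x∉U = ⊥-elim (v (ℤ.≤-trans (+≤+ (∣insert-∩∣≤-∉ I U x∉U)) (I∈𝓘 J)))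
    where U = unionOver J A

  tight-cover : ∀ {I} → 𝓘 I → (P : Fin n → Set) →
                (∀ x → ∃ λ J → Tight I J × (P x → x ∈ unionOver J A)) →
                ∃ λ T → Tight I T × (∀ x → P x → x ∈ unionOver T A)
  tight-cover {I} I∈𝓘 P cover =
    let (T , tT , covers) = cover-list (allFin n) in T , tT , λ x → covers (∈-allFin x)
    where
    cover-list : (xs : List (Fin n)) →
                 ∃ λ T → Tight I T × (∀ {x} → x List.∈ xs → P x → x ∈ unionOver T A)
    cover-list []       = ⊥ , tight-⊥ I , λ ()
    cover-list (x ∷ xs) with cover x | cover-list xs
    ... | J , tJ , coversJ | T , tT , coversT = J ∪ T , tight-∪ {I} {J} {T} I∈𝓘 tJ tT , covers
      where
      covers : ∀ {y} → y List.∈ x ∷ xs → P y → y ∈ unionOver (J ∪ T) A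
      covers (Any.here refl) Px = subst (x ∈_) (sym (unionOver-∪ J T A)) (x∈p∪q⁺ (inj₁ (coversJ Px)))
      covers (Any.there y∈) Py  = subst (_ ∈_) (sym (unionOver-∪ J T A)) (x∈p∪q⁺ (inj₂ (coversT y∈ Py)))

  Extension : Subset n → Subset n → Fin n → Set
  Extension I I′ x = x ∈ I′ × x ∉ I × 𝓘 (I ∪ ⁅ x ⁆)

  blocking : ∀ {I I′} → 𝓘 I → ¬ ∃ (Extension I I′) →
             ∀ x → ∃ λ J → Tight I J × (x ∈ I′ × x ∉ I → x ∈ unionOver J A)
  blocking {I} I∈𝓘 stuck x with indep-or-violated (I ∪ ⁅ x ⁆)
  ... | inj₁ I+x∈𝓘   = ⊥ , tight-⊥ I , λ (x∈I′ , x∉I) → ⊥-elim (stuck (x , x∈I′ , x∉I , I+x∈𝓘))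
  ... | inj₂ (J , v) = let (tJ , x∈A) = violated-tight {I} {J} {x} I∈𝓘 v in J , tJ , λ _ → x∈A

  -- Then the union T of these J is tight with A(T) ⊇ I′ ∖ I, so
  -- |I′ ∩ A(T)| ≤ g(T) ≤ |I ∩ A(T)| and I′ ∖ A(T) ⊆ I give |I′| ≤ |I|.
  unextendable⇒≤ : ∀ {I I′} → 𝓘 I → 𝓘 I′ → ¬ ∃ (Extension I I′) → ∣ I′ ∣ ℕ.≤ ∣ I ∣
  unextendable⇒≤ {I} {I′} I∈𝓘 I′∈𝓘 stuck
    with tight-cover {I} I∈𝓘 (λ x → x ∈ I′ × x ∉ I) (blocking I∈𝓘 stuck)
  ... | T , tT , covers = ∣p∣≤∣q∣-via S I′ I ∣I′∩S∣≤∣I∩S∣ outside-S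
    where
    S = unionOver T A
    ∣I′∩S∣≤∣I∩S∣ : ∣ I′ ∩ S ∣ ℕ.≤ ∣ I ∩ S ∣
    ∣I′∩S∣≤∣I∩S∣ = ℤ.drop‿+≤+ (ℤ.≤-trans (I′∈𝓘 T) tT)
    outside-S : ∀ {x} → x ∈ I′ → x ∉ S → x ∈ I
    outside-S {x} x∈I′ x∉S with x ∈? I
    ... | yes x∈I = x∈I
    ... | no  x∉I = ⊥-elim (x∉S (covers x (x∈I′ , x∉I)))

  𝓘-augment : ∀ {I I′} → 𝓘 I → 𝓘 I′ → ∣ I ∣ ℕ.< ∣ I′ ∣ → Σ (Fin n) (Extension I I′)
  𝓘-augment {I} {I′} I∈𝓘 I′∈𝓘 ∣I∣<∣I′∣
    with any? (λ x → (x ∈? I′) ×-dec (¬? (x ∈? I)) ×-dec indep? (I ∪ ⁅ x ⁆))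
  ... | yes extension = extension
  ... | no  stuck     = ⊥-elim (ℕ.<⇒≱ ∣I∣<∣I′∣ (unextendable⇒≤ I∈𝓘 I′∈𝓘 stuck))

-- The empty set is independent since 𝓘 is hereditary and non-empty.
mainTheorem2 : (n k : ℕ) (A : Fin k → Subset n) (b : Fin k → ℤ) →
    Σ (Subset n) (Indep A b) → IsMatroid (Indep A b)
mainTheorem2 n k A b (I₀ , I₀∈𝓘) = record
  { empty-indep = 𝓘-hereditary {I₀} ⊥⊆ I₀∈𝓘
  ; hereditary  = 𝓘-hereditary
  ; augment     = 𝓘-augment
  }
  where open Constraints A b
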